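{- Let $\tau$ and $\tau'$ be two permutations of $\{1,\dots,m+1\}$, both without self-overlaps, such that $\tau(1)=\tau'(1)$ and $\tau(m+1)=\tau'(m+1)$. Then for all integers $n\ge0$ and $k\ge0$, the number of permutations of $\{1,\dots,n\}$ with exactly $k$ occurrences of $\tau$ equals the number of permutations of $\{1,\dots,n\}$ with exactly $k$ occurrences of $\tau'$. (That is, the number of permutations of length $n$ with $k$ occurrences of a non-self-overlapping pattern $\tau$ of length $m+1$ depends only on $n,k,m,\tau(1),\tau(m+1)$.)
   Context: For a word $s=s_1\dots s_j$ of distinct integers, $\mathrm{st}(s)$ is the permutation $\rho$ of $\{1,\dots,j\}$ with $s_i<s_l\iff\rho_i<\rho_l$. An occurrence of a pattern $\tau$ of length $j$ in a permutation $\sigma=\sigma_1\dots\sigma_n$ is an index $i$ with $\mathrm{st}(\sigma_i\dots\sigma_{i+j-1})=\tau$. A pattern $\tau$ of length $j$ has no self-overlaps if every permutation of length at most $2j-2$ has at most one occurrence of $\tau$. -}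

module Defs where

open import Data.Nat using (ℕ; zero; suc; _∸_; _*_; _<_; _≤_; _<ᵇ_; _≡ᵇ_; _≟_)
open import Data.Nat.Properties using (_<?_)
open import Data.Bool using (Bool; true; false; _∧_; T)
open import Data.Bool.Properties using () renaming (_≟_ to _≟ᵇ_)
open import Data.List using (List; []; _∷_; length; map; concatMap; upTo; take; drop; filter; foldr; cartesianProduct)
open import Data.List.Relation.Unary.All using (All; all?)
open import Data.List.Relation.Unary.Unique.DecPropositional _≟_ using (Unique; unique?)
open import Data.Product using (_×_; _,_)
open import Relation.Binary.PropositionalEquality using (_≡_)
open import Relation.Nullary using (Dec; _×-dec_)
open import Relation.Nullary.Decidable using (does)

-- Convention: permutations are written in one-line notation with values
-- 0,…,n-1 (instead of 1,…,n); only relative order matters below.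

IsPerm : ℕ → List ℕ → Set
IsPerm n l = length l ≡ n × Unique l × All (_< n) l

isPerm? : ∀ n l → Dec (IsPerm n l)
isPerm? n l = (length l ≟ n) ×-dec (unique? l ×-dec all? (_<? n) l)

words : ℕ → ℕ → List (List ℕ)
words n zero      = [] ∷ []
words n (suc len) = concatMap (λ x → map (x ∷_) (words n len)) (upTo n)

-- i-th entry (0-based), default 0 outside the range (never used there)
nth : List ℕ → ℕ → ℕ
nth []       _       = 0
nth (x ∷ xs) zero    = x
nth (x ∷ xs) (suc i) = nth xs i

-- st(s) = t  (for t a permutation): s and t have the same length and
-- for all positions a, b:  s_a < s_b  iff  t_a < t_b.
stIs : List ℕ → List ℕ → Bool
stIs s t = (length s ≡ᵇ length t) ∧
  foldr _∧_ true (map (λ { (a , b) → does (((nth s a) <ᵇ (nth s b)) ≟ᵇ ((nth t a) <ᵇ (nth t b))) })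
      (cartesianProduct (upTo (length t)) (upTo (length t))))

occurrences : List ℕ → List ℕ → ℕ
occurrences τ σ =
  length (filter (λ i → T? (stIs (take (length τ) (drop i σ)) τ))
                 (upTo (suc (length σ) ∸ length τ)))
  where
  open import Data.Bool.Properties using (T?)

-- τ (of length j) has no self-overlaps: every permutation of length at
-- most 2j-2 has at most one occurrence of τ.
NoSelfOverlap : List ℕ → Set
NoSelfOverlap τ = ∀ n (σ : List ℕ) → n ≤ 2 * length τ ∸ 2 → IsPerm n σ →
  occurrences τ σ ≤ 1

countPerms : List ℕ → ℕ → ℕ → ℕ
countPerms τ n k =
  length (filter (λ σ → isPerm? n σ ×-dec (occurrences τ σ ≟ k)) (words n n))

module Submission where

-- Proof (inclusion–exclusion on marked occurrences).  Call a subset b of the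
-- positions {0,…,n-1} a marking, and let N_τ(b) be the number of permutations
-- σ of length n in which every marked position starts an occurrence of τ.
--  (1) Binomial moments.  Choosing j of the occurrences of τ in σ gives
--      Σ_σ C(occ_τ σ, j) = Σ_{|b| = j} N_τ(b).
--  (2) Binomial moments determine a finite distribution (the system
--      M_j = Σ_k C(k,j) c_k is triangular), so it suffices that
--      N_τ(b) = N_τ′(b) for every marking b.
--  (3) Without self-overlaps, marked occurrences in a permutation start at
--      least m apart, so the windows [i, i+m] of marked starts i share at
--      most an endpoint.  Let π be the relabelling of window offsets with
--      τ(π a) = τ′(a); it fixes 0 and m because the first and last letters
--      agree.  Permuting σ inside every marked window by π turns a
--      permutation counted by N_τ(b) into one counted by N_τ′(b), and π⁻¹
--      undoes it; by symmetry N_τ(b) = N_τ′(b).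

open import Defs
open import Algebra.Properties.CommutativeSemigroup using (interchange)
open import Data.Bool using (Bool; true; false; _∧_; _∨_; not; T; if_then_else_)
open import Data.Bool.Properties using (T?; ∧-zeroʳ) renaming (_≟_ to _≟ᵇ_)
open import Data.Empty using (⊥; ⊥-elim)
open import Data.List using (List; []; _∷_; _++_; map; length; filter; take; drop; upTo; applyUpTo; foldr; cartesianProduct; concatMap; head; last)
open import Data.List.Membership.Propositional using (_∈_; find)
open import Data.List.Membership.Propositional.Properties
open import Data.List.Properties using (length-++; length-map; length-upTo; length-applyUpTo; map-upTo; ∷-injectiveˡ; ∷-injectiveʳ)
open import Data.List.Relation.Unary.All using (All; []; _∷_; tabulate; lookup)
open import Data.List.Relation.Unary.All.Properties using (¬Any⇒All¬)
open import Data.List.Relation.Unary.Any using (here; there)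
import Data.List.Relation.Unary.Any as Any
open import Data.List.Relation.Unary.AllPairs using ([]; _∷_)
open import Data.List.Relation.Unary.Unique.Propositional using (Unique)
import Data.List.Relation.Unary.Unique.Propositional.Properties as Unique
open import Data.Maybe using (Maybe; just; nothing)
open import Data.Nat using (ℕ; zero; suc; _+_; _*_; _∸_; _≤_; _<_; z≤n; s≤s; z<s; _≡ᵇ_; _<ᵇ_; _≤ᵇ_; _≟_)
open import Data.Nat.Combinatorics using (_C_; k>n⇒nCk≡0; nCn≡1; nCk+nC[k+1]≡[n+1]C[k+1])
open import Data.Nat.Properties
open import Data.List.Membership.DecPropositional _≟_ using (_∈?_)
open import Data.Product using (_×_; _,_; proj₁; proj₂; map₁; map₂)
open import Data.Sum using (inj₁; inj₂)
open import Data.Unit using (tt)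
open import Relation.Binary using (tri<; tri≈; tri>)
open import Relation.Binary.PropositionalEquality
open import Relation.Nullary using (Dec; yes; no; does; ¬_)

private
  variable
    A B : Set

ind : Bool → ℕ
ind true  = 1
ind false = 0

ind-∧ : ∀ a b → ind (a ∧ b) ≡ ind a * ind b
ind-∧ true  b = sym (+-identityʳ (ind b))
ind-∧ false b = refl

Σl : List A → (A → ℕ) → ℕ
Σl []       h = 0
Σl (x ∷ xs) h = h x + Σl xs h

Σl-cong : ∀ (xs : List A) {h g : A → ℕ} → (∀ x → h x ≡ g x) → Σl xs h ≡ Σl xs g
Σl-cong []       e = refl
Σl-cong (x ∷ xs) e = cong₂ _+_ (e x) (Σl-cong xs e)

Σl-zero : ∀ (xs : List A) (h : A → ℕ) → (∀ x → h x ≡ 0) → Σl xs h ≡ 0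
Σl-zero []       h e = refl
Σl-zero (x ∷ xs) h e rewrite e x = Σl-zero xs h e

Σl-++ : ∀ (xs ys : List A) (h : A → ℕ) → Σl (xs ++ ys) h ≡ Σl xs h + Σl ys h
Σl-++ []       ys h = refl
Σl-++ (x ∷ xs) ys h = trans (cong (h x +_) (Σl-++ xs ys h)) (sym (+-assoc (h x) _ _))

Σl-map : (f : A → B) (xs : List A) (h : B → ℕ) → Σl (map f xs) h ≡ Σl xs (λ x → h (f x))
Σl-map f []       h = refl
Σl-map f (x ∷ xs) h = cong (h (f x) +_) (Σl-map f xs h)

Σl-+ : ∀ (xs : List A) (h g : A → ℕ) → Σl xs (λ x → h x + g x) ≡ Σl xs h + Σl xs g
Σl-+ []       h g = refl
Σl-+ (x ∷ xs) h g rewrite Σl-+ xs h g = interchange +-commutativeSemigroup (h x) (g x) (Σl xs h) (Σl xs g)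

Σl-*ˡ : ∀ (xs : List A) (c : ℕ) (h : A → ℕ) → Σl xs (λ x → c * h x) ≡ c * Σl xs h
Σl-*ˡ []       c h = sym (*-zeroʳ c)
Σl-*ˡ (x ∷ xs) c h rewrite Σl-*ˡ xs c h = sym (*-distribˡ-+ c (h x) (Σl xs h))

Σl-swap : (xs : List A) (ys : List B) (h : A → B → ℕ) →
  Σl xs (λ x → Σl ys (h x)) ≡ Σl ys (λ y → Σl xs (λ x → h x y))
Σl-swap []       ys h = sym (Σl-zero ys _ (λ _ → refl))
Σl-swap (x ∷ xs) ys h rewrite Σl-swap xs ys h = sym (Σl-+ ys (h x) (λ y → Σl xs (λ x' → h x' y)))

Σl-mono : ∀ (xs : List A) (f g : A → ℕ) → (∀ x → f x ≤ g x) → Σl xs f ≤ Σl xs g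
Σl-mono []       f g le = z≤n
Σl-mono (x ∷ xs) f g le = +-mono-≤ (le x) (Σl-mono xs f g le)

Σl-mono-< : ∀ (xs : List A) (f g : A → ℕ) → (∀ x → f x ≤ g x) → ∀ {z} → z ∈ xs → f z < g z → Σl xs f < Σl xs g
Σl-mono-< (x ∷ xs) f g le (here refl) lt = +-mono-<-≤ lt (Σl-mono xs f g le)
Σl-mono-< (x ∷ xs) f g le (there z∈) lt = +-mono-≤-< (le x) (Σl-mono-< xs f g le z∈ lt)

length-filter-Σ : ∀ {P : A → Set} (P? : ∀ x → Dec (P x)) (xs : List A) →
  length (filter P? xs) ≡ Σl xs (λ x → ind (does (P? x)))
length-filter-Σ P? []       = refl
length-filter-Σ P? (x ∷ xs) with does (P? x)
... | true  = cong suc (length-filter-Σ P? xs)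
... | false = length-filter-Σ P? xs

Σl-ind-≤ : ∀ (xs : List A) (h : A → Bool) → Σl xs (λ x → ind (h x)) ≤ length xs
Σl-ind-≤ []       h = z≤n
Σl-ind-≤ (x ∷ xs) h with h x
... | true  = s≤s (Σl-ind-≤ xs h)
... | false = m≤n⇒m≤1+n (Σl-ind-≤ xs h)

Σl-ind-< : ∀ (xs : List A) (h : A → Bool) {z} → z ∈ xs → h z ≡ false → Σl xs (λ x → ind (h x)) < length xs
Σl-ind-< (x ∷ xs) h (here refl) e rewrite e = s≤s (Σl-ind-≤ xs h)
Σl-ind-< (x ∷ xs) h (there z∈) e with h x
... | true  = s≤s (Σl-ind-< xs h z∈ e)
... | false = m≤n⇒m≤1+n (Σl-ind-< xs h z∈ e)

Σl-member : ∀ (xs : List A) (h : A → ℕ) {z} → z ∈ xs → h z ≤ Σl xs h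
Σl-member (x ∷ xs) h (here refl) = m≤m+n (h x) _
Σl-member (x ∷ xs) h (there z∈) = ≤-trans (Σl-member xs h z∈) (m≤n+m _ (h x))

Σl-two : ∀ (xs : List A) (h : A → ℕ) {y z} → y ∈ xs → z ∈ xs → y ≢ z → 1 ≤ h y → 1 ≤ h z → 2 ≤ Σl xs h
Σl-two (x ∷ xs) h (here refl) (here refl) y≢z _  _  = ⊥-elim (y≢z refl)
Σl-two (x ∷ xs) h (here refl) (there z∈)  _   hy hz = +-mono-≤ hy (≤-trans hz (Σl-member xs h z∈))
Σl-two (x ∷ xs) h (there y∈)  (here refl) _   hy hz = +-mono-≤ hz (≤-trans hy (Σl-member xs h y∈))
Σl-two (x ∷ xs) h (there y∈)  (there z∈)  y≢z hy hz = ≤-trans (Σl-two xs h y∈ z∈ y≢z hy hz) (m≤n+m _ (h x))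

Σr : ℕ → (ℕ → ℕ) → ℕ
Σr zero    h = 0
Σr (suc N) h = h 0 + Σr N (λ k → h (suc k))

Σr-cong : ∀ N {h g : ℕ → ℕ} → (∀ k → k < N → h k ≡ g k) → Σr N h ≡ Σr N g
Σr-cong zero    e = refl
Σr-cong (suc N) e = cong₂ _+_ (e 0 z<s) (Σr-cong N (λ k k<N → e (suc k) (s≤s k<N)))

Σr-zero : ∀ N (h : ℕ → ℕ) → (∀ k → k < N → h k ≡ 0) → Σr N h ≡ 0
Σr-zero zero    h e = refl
Σr-zero (suc N) h e rewrite e 0 z<s = Σr-zero N _ (λ k k<N → e (suc k) (s≤s k<N))

Σr-split : ∀ a b (h : ℕ → ℕ) → Σr (a + b) h ≡ Σr a h + Σr b (λ i → h (a + i))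
Σr-split zero    b h = refl
Σr-split (suc a) b h rewrite Σr-split a b (λ k → h (suc k)) = sym (+-assoc (h 0) _ _)

Σr-Σl : ∀ N (xs : List A) (h : ℕ → A → ℕ) →
  Σr N (λ k → Σl xs (h k)) ≡ Σl xs (λ x → Σr N (λ k → h k x))
Σr-Σl zero    xs h = sym (Σl-zero xs _ (λ _ → refl))
Σr-Σl (suc N) xs h rewrite Σr-Σl N xs (λ k → h (suc k)) = sym (Σl-+ xs (h 0) (λ x → Σr N (λ k → h (suc k) x)))

Σr-point : ∀ N x (h : ℕ → ℕ) → x < N → Σr N (λ k → h k * ind (x ≡ᵇ k)) ≡ h x
Σr-point (suc N) zero    h _ = trans (cong₂ _+_ (*-identityʳ (h 0)) (Σr-zero N _ (λ k _ → *-zeroʳ (h (suc k))))) (+-identityʳ (h 0))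
Σr-point (suc N) (suc x) h (s≤s x<N) = trans (cong (_+ Σr N (λ k → h (suc k) * ind (x ≡ᵇ k))) (*-zeroʳ (h 0))) (Σr-point N x (λ k → h (suc k)) x<N)

moment-from : ∀ N j (c : ℕ → ℕ) → j < N →
  Σr N (λ k → (k C j) * c k) ≡ c j + Σr (N ∸ suc j) (λ i → ((suc j + i) C j) * c (suc j + i))
moment-from N j c j<N = begin
    Σr N h
  ≡⟨ cong (λ z → Σr z h) N≡j+1+s ⟩
    Σr (j + suc s) h
  ≡⟨ Σr-split j (suc s) h ⟩
    Σr j h + (h (j + 0) + Σr s (λ i → h (j + suc i)))
  ≡⟨ cong₂ _+_ below-j (cong₂ _+_ at-j (Σr-cong s (λ i _ → cong h (+-suc j i)))) ⟩
    c j + Σr s (λ i → h (suc j + i)) ∎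
  where
  open ≡-Reasoning
  h = λ k → (k C j) * c k
  s = N ∸ suc j
  N≡j+1+s : N ≡ j + suc s
  N≡j+1+s = sym (trans (+-suc j s) (m+[n∸m]≡n j<N))
  below-j : Σr j h ≡ 0
  below-j = Σr-zero j h (λ k k<j → cong (_* c k) (k>n⇒nCk≡0 k<j))
  at-j : h (j + 0) ≡ c j
  at-j = trans (cong h (+-identityʳ j)) (trans (cong (_* c j) (nCn≡1 j)) (*-identityˡ (c j)))

-- Binomial inversion: finitely supported sequences with the same binomial
-- moments are equal (the moment system is unitriangular).
binomial-inversion : ∀ N (c d : ℕ → ℕ) → (∀ k → N ≤ k → c k ≡ 0) → (∀ k → N ≤ k → d k ≡ 0) →
  (∀ j → Σr N (λ k → (k C j) * c k) ≡ Σr N (λ k → (k C j) * d k)) → ∀ k → c k ≡ d k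
binomial-inversion N c d c-supp d-supp moments k = agree N k (m≤n+m N k)
  where
  -- downward induction: c and d agree at every k with N ≤ k + r
  agree : ∀ r k → N ≤ k + r → c k ≡ d k
  agree zero k le = trans (c-supp k N≤k) (sym (d-supp k N≤k))
    where N≤k = ≤-trans le (≤-reflexive (+-identityʳ k))
  agree (suc r) k le with N ≤? k
  ... | yes N≤k = trans (c-supp k N≤k) (sym (d-supp k N≤k))
  ... | no  N≰k = +-cancelʳ-≡ (tail c) (c k) (d k) (begin
      c k + tail c              ≡⟨ sym (moment-from N k c k<N) ⟩
      Σr N (λ i → (i C k) * c i)  ≡⟨ moments k ⟩
      Σr N (λ i → (i C k) * d i)  ≡⟨ moment-from N k d k<N ⟩
      d k + tail d              ≡⟨ cong (d k +_) (sym tails-agree) ⟩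
      d k + tail c              ∎)
    where
    open ≡-Reasoning
    k<N = ≰⇒> N≰k
    tail : (ℕ → ℕ) → ℕ
    tail e = Σr (N ∸ suc k) (λ i → ((suc k + i) C k) * e (suc k + i))
    tails-agree : tail c ≡ tail d
    tails-agree = Σr-cong (N ∸ suc k) (λ i _ → cong (((suc k + i) C k) *_)
      (agree r (suc k + i) (≤-trans le (≤-trans (≤-reflexive (+-suc k r)) (+-monoˡ-≤ r (m≤m+n (suc k) i))))))

distribution : (W : List A) (p : A → Bool) (h : A → ℕ) → ℕ → ℕ
distribution W p h k = Σl W (λ x → ind (p x ∧ (h x ≡ᵇ k)))

module _ (W : List A) (p : A → Bool) (N : ℕ) where

  distribution-beyond : (h : A → ℕ) → (∀ x → p x ≡ true → h x < N) →
    ∀ k → N ≤ k → distribution W p h k ≡ 0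
  distribution-beyond h h<N k N≤k = Σl-zero W _ point
    where
    point : ∀ x → ind (p x ∧ (h x ≡ᵇ k)) ≡ 0
    point x with p x in px
    ... | false = refl
    ... | true with h x ≡ᵇ k in hx
    ...   | false = refl
    ...   | true  = ⊥-elim (<⇒≱ (h<N x px) (≤-trans N≤k (≤-reflexive (sym (≡ᵇ⇒≡ (h x) k (subst T (sym hx) tt))))))

  moment-distribution : (h : A → ℕ) → (∀ x → p x ≡ true → h x < N) → ∀ j →
    Σl W (λ x → ind (p x) * (h x C j)) ≡ Σr N (λ k → (k C j) * distribution W p h k)
  moment-distribution h h<N j = sym (begin
      Σr N (λ k → (k C j) * distribution W p h k)
    ≡⟨ Σr-cong N (λ k _ → sym (Σl-*ˡ W (k C j) _)) ⟩
      Σr N (λ k → Σl W (λ x → (k C j) * ind (p x ∧ (h x ≡ᵇ k))))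
    ≡⟨ Σr-Σl N W _ ⟩
      Σl W (λ x → Σr N (λ k → (k C j) * ind (p x ∧ (h x ≡ᵇ k))))
    ≡⟨ Σl-cong W point ⟩
      Σl W (λ x → ind (p x) * (h x C j)) ∎)
    where
    open ≡-Reasoning
    point : ∀ x → Σr N (λ k → (k C j) * ind (p x ∧ (h x ≡ᵇ k))) ≡ ind (p x) * (h x C j)
    point x with p x in px
    ... | false = Σr-zero N _ (λ k _ → *-zeroʳ (k C j))
    ... | true  = trans (Σr-point N (h x) (_C j) (h<N x px)) (sym (+-identityʳ _))

  equal-moments⇒equidistributed : (f g : A → ℕ) →
    (∀ x → p x ≡ true → f x < N) → (∀ x → p x ≡ true → g x < N) →
    (∀ j → Σl W (λ x → ind (p x) * (f x C j)) ≡ Σl W (λ x → ind (p x) * (g x C j))) →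
    ∀ k → distribution W p f k ≡ distribution W p g k
  equal-moments⇒equidistributed f g f<N g<N moments =
    binomial-inversion N (distribution W p f) (distribution W p g)
      (distribution-beyond f f<N) (distribution-beyond g g<N)
      (λ j → trans (sym (moment-distribution f f<N j)) (trans (moments j) (moment-distribution g g<N j)))

-- Markings: a marking of n positions is a boolean list of length n.
subsets : ℕ → List (List Bool)
subsets zero    = [] ∷ []
subsets (suc n) = map (false ∷_) (subsets n) ++ map (true ∷_) (subsets n)

size : List Bool → ℕ
size b = Σl b ind

-- Inclusion of markings (b may be shorter than c).
_⊆ᵇ_ : List Bool → List Bool → Bool
[]      ⊆ᵇ _       = true
(_ ∷ _) ⊆ᵇ []      = false
(x ∷ b) ⊆ᵇ (y ∷ c) = (not x ∨ y) ∧ (b ⊆ᵇ c)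

-- The marking c has C(|c|, j) sub-markings of size j (Pascal's rule).
subsets-of-size : ∀ c j → Σl (subsets (length c)) (λ b → ind ((size b ≡ᵇ j) ∧ (b ⊆ᵇ c))) ≡ size c C j
subsets-of-size []      zero    = refl
subsets-of-size []      (suc j) = refl
subsets-of-size (y ∷ c) j = begin
    Σl (map (false ∷_) Bs ++ map (true ∷_) Bs) F
  ≡⟨ Σl-++ (map (false ∷_) Bs) _ F ⟩
    Σl (map (false ∷_) Bs) F + Σl (map (true ∷_) Bs) F
  ≡⟨ cong₂ _+_ (Σl-map (false ∷_) Bs F) (Σl-map (true ∷_) Bs F) ⟩
    Σl Bs (λ b → ind ((size b ≡ᵇ j) ∧ (b ⊆ᵇ c))) + with-y y j
  ≡⟨ cong (_+ with-y y j) (subsets-of-size c j) ⟩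
    size c C j + with-y y j
  ≡⟨ pascal y j ⟩
    size (y ∷ c) C j ∎
  where
  open ≡-Reasoning
  Bs = subsets (length c)
  F = λ b → ind ((size b ≡ᵇ j) ∧ (b ⊆ᵇ (y ∷ c)))
  with-y : Bool → ℕ → ℕ
  with-y y j = Σl Bs (λ b → ind ((suc (size b) ≡ᵇ j) ∧ (y ∧ (b ⊆ᵇ c))))
  pascal : ∀ y j → size c C j + with-y y j ≡ size (y ∷ c) C j
  pascal false j = trans (cong (size c C j +_) (Σl-zero Bs _ (λ b → cong ind (∧-zeroʳ (suc (size b) ≡ᵇ j))))) (+-identityʳ _)
  pascal true zero    = cong (1 +_) (Σl-zero Bs _ (λ b → refl))
  pascal true (suc j) = begin
      size c C suc j + with-y true (suc j)
    ≡⟨ cong (size c C suc j +_) (subsets-of-size c j) ⟩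
      size c C suc j + size c C j
    ≡⟨ +-comm (size c C suc j) _ ⟩
      size c C j + size c C suc j
    ≡⟨ nCk+nC[k+1]≡[n+1]C[k+1] (size c) j ⟩
      suc (size c) C suc j ∎

-- i-th entry of a marking (false beyond its end).
marked : List Bool → ℕ → Bool
marked []      _       = false
marked (x ∷ b) zero    = x
marked (x ∷ b) (suc i) = marked b i

∧-true : ∀ a b → (a ∧ b) ≡ true → a ≡ true × b ≡ true
∧-true true true _ = refl , refl

⊆ᵇ-marked : ∀ b c → (b ⊆ᵇ c) ≡ true → ∀ i → marked b i ≡ true → marked c i ≡ true
⊆ᵇ-marked (true ∷ b)  (true ∷ c)  _  zero    _  = refl
⊆ᵇ-marked (true ∷ b)  (false ∷ c) () zero    _
⊆ᵇ-marked (false ∷ b) (y ∷ c)     _  zero    ()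
⊆ᵇ-marked (x ∷ b)     (y ∷ c)     ⊆  (suc i) bi = ⊆ᵇ-marked b c (proj₂ (∧-true (not x ∨ y) _ ⊆)) i bi

⊆ᵇ-length : ∀ b c → (b ⊆ᵇ c) ≡ true → length b ≤ length c
⊆ᵇ-length []      c       _ = z≤n
⊆ᵇ-length (x ∷ b) (y ∷ c) ⊆ = s≤s (⊆ᵇ-length b c (proj₂ (∧-true (not x ∨ y) _ ⊆)))

marked-⊆ᵇ : ∀ b c → length b ≤ length c → (∀ i → marked b i ≡ true → marked c i ≡ true) → (b ⊆ᵇ c) ≡ true
marked-⊆ᵇ []          c       _         _  = refl
marked-⊆ᵇ (false ∷ b) (y ∷ c) (s≤s b≤c) bc = marked-⊆ᵇ b c b≤c (λ i → bc (suc i))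
marked-⊆ᵇ (true ∷ b)  (y ∷ c) (s≤s b≤c) bc rewrite bc 0 refl = marked-⊆ᵇ b c b≤c (λ i → bc (suc i))

≡true⇒T : ∀ {b} → b ≡ true → T b
≡true⇒T refl = tt

T⇒≡true : ∀ b → T b → b ≡ true
T⇒≡true true _ = refl

≟ᵇ-sound : ∀ x y → does (x ≟ᵇ y) ≡ true → x ≡ y
≟ᵇ-sound false false _ = refl
≟ᵇ-sound true  true  _ = refl

≟ᵇ-refl : ∀ x → does (x ≟ᵇ x) ≡ true
≟ᵇ-refl false = refl
≟ᵇ-refl true  = refl

<ᵇ-true : ∀ {x y} → x < y → (x <ᵇ y) ≡ true
<ᵇ-true {x} {y} x<y = T⇒≡true (x <ᵇ y) (<⇒<ᵇ x<y)

<ᵇ-false : ∀ {x y} → y ≤ x → (x <ᵇ y) ≡ false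
<ᵇ-false {x} {y} y≤x with x <ᵇ y in x<ᵇy
... | false = refl
... | true  = ⊥-elim (<⇒≱ (<ᵇ⇒< x y (≡true⇒T x<ᵇy)) y≤x)

and-map⁻ : (f : A → Bool) (xs : List A) → foldr _∧_ true (map f xs) ≡ true → ∀ {z} → z ∈ xs → f z ≡ true
and-map⁻ f (x ∷ xs) e z∈ with f x in fx | z∈
... | true | here refl = fx
... | true | there z∈xs = and-map⁻ f xs e z∈xs

and-map⁺ : (f : A → Bool) (xs : List A) → (∀ {z} → z ∈ xs → f z ≡ true) → foldr _∧_ true (map f xs) ≡ true
and-map⁺ f []       _ = refl
and-map⁺ f (x ∷ xs) h rewrite h (here refl) = and-map⁺ f xs (λ z∈ → h (there z∈))

nth-take : ∀ k (xs : List ℕ) a → a < k → nth (take k xs) a ≡ nth xs a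
nth-take (suc k) []       a       _         = refl
nth-take (suc k) (x ∷ xs) zero    _         = refl
nth-take (suc k) (x ∷ xs) (suc a) (s≤s a<k) = nth-take k xs a a<k

nth-drop : ∀ i (xs : List ℕ) a → nth (drop i xs) a ≡ nth xs (i + a)
nth-drop zero    xs       a = refl
nth-drop (suc i) []       a = refl
nth-drop (suc i) (x ∷ xs) a = nth-drop i xs a

nth-window : ∀ i k (xs : List ℕ) a → a < k → nth (take k (drop i xs)) a ≡ nth xs (i + a)
nth-window i k xs a a<k = trans (nth-take k (drop i xs) a a<k) (nth-drop i xs a)

nth-∈ : ∀ (xs : List ℕ) a → a < length xs → nth xs a ∈ xs
nth-∈ (x ∷ xs) zero    _         = here refl
nth-∈ (x ∷ xs) (suc a) (s≤s a<l) = there (nth-∈ xs a a<l)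

nth-All : ∀ {P : ℕ → Set} (xs : List ℕ) a → All P xs → a < length xs → P (nth xs a)
nth-All xs a all a<l = lookup all (nth-∈ xs a a<l)

nth-injective : ∀ (xs : List ℕ) a c → Unique xs → a < length xs → c < length xs → nth xs a ≡ nth xs c → a ≡ c
nth-injective (x ∷ xs) zero    zero    _          _         _         _ = refl
nth-injective (x ∷ xs) zero    (suc c) (x∉ ∷ _)   _         (s≤s c<l) e = ⊥-elim (lookup x∉ (nth-∈ xs c c<l) e)
nth-injective (x ∷ xs) (suc a) zero    (x∉ ∷ _)   (s≤s a<l) _         e = ⊥-elim (lookup x∉ (nth-∈ xs a a<l) (sym e))
nth-injective (x ∷ xs) (suc a) (suc c) (_ ∷ uxs)  (s≤s a<l) (s≤s c<l) e = cong suc (nth-injective xs a c uxs a<l c<l e)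

nth-applyUpTo : ∀ (h : ℕ → ℕ) n q → q < n → nth (applyUpTo h n) q ≡ h q
nth-applyUpTo h (suc n) zero    _         = refl
nth-applyUpTo h (suc n) (suc q) (s≤s q<n) = nth-applyUpTo (λ i → h (suc i)) n q q<n

length-take : ∀ k (ys : List A) → k ≤ length ys → length (take k ys) ≡ k
length-take zero    ys       _         = refl
length-take (suc k) (y ∷ ys) (s≤s k≤l) = cong suc (length-take k ys k≤l)

length-take⁻ : ∀ k (ys : List A) → length (take k ys) ≡ k → k ≤ length ys
length-take⁻ zero    ys       _ = z≤n
length-take⁻ (suc k) []       ()
length-take⁻ (suc k) (y ∷ ys) e = s≤s (length-take⁻ k ys (suc-injective e))

length-drop : ∀ i k (xs : List A) → i + k ≤ length xs → k ≤ length (drop i xs)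
length-drop zero    k xs       le        = le
length-drop (suc i) k (x ∷ xs) (s≤s le) = length-drop i k xs le

length-drop⁻ : ∀ i k (xs : List A) → k ≤ length (drop i xs) → 0 < k → i + k ≤ length xs
length-drop⁻ zero    k xs       le _   = le
length-drop⁻ (suc i) k []       le 0<k = ⊥-elim (<⇒≱ 0<k le)
length-drop⁻ (suc i) k (x ∷ xs) le 0<k = s≤s (length-drop⁻ i k xs le 0<k)

window-fits : ∀ i k (xs : List A) → i + k ≤ length xs → length (take k (drop i xs)) ≡ k
window-fits i k xs le = length-take k (drop i xs) (length-drop i k xs le)

window-fits⁻ : ∀ i k (xs : List A) → 0 < k → length (take k (drop i xs)) ≡ k → i + k ≤ length xs
window-fits⁻ i k xs 0<k e = length-drop⁻ i k xs (length-take⁻ k (drop i xs) e) 0<k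

SameOrder : List ℕ → List ℕ → ℕ → Set
SameOrder s t L = ∀ a c → a < L → c < L → (nth s a <ᵇ nth s c) ≡ (nth t a <ᵇ nth t c)

stIs-sound : ∀ s t → stIs s t ≡ true → length s ≡ length t × SameOrder s t (length t)
stIs-sound s t e with ∧-true _ _ e
... | same-length , all-pairs = ≡ᵇ⇒≡ _ _ (≡true⇒T same-length) , λ a c a<L c<L →
  ≟ᵇ-sound _ _ (and-map⁻ _ _ all-pairs (∈-cartesianProduct⁺ (∈-upTo⁺ a<L) (∈-upTo⁺ c<L)))

stIs-complete : ∀ s t → length s ≡ length t → SameOrder s t (length t) → stIs s t ≡ true
stIs-complete s t e same rewrite e | T⇒≡true (length t ≡ᵇ length t) (≡⇒≡ᵇ (length t) (length t) refl) =
  and-map⁺ _ _ pair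
  where
  pair : ∀ {z} → z ∈ cartesianProduct (upTo (length t)) (upTo (length t)) → _
  pair {a , c} z∈ with ∈-cartesianProduct⁻ (upTo (length t)) (upTo (length t)) z∈
  ... | a∈ , c∈ = trans (cong (λ z → does (z ≟ᵇ (nth t a <ᵇ nth t c))) (same a c (∈-upTo⁻ a∈) (∈-upTo⁻ c∈)))
                         (≟ᵇ-refl (nth t a <ᵇ nth t c))

OccursAt : List ℕ → List ℕ → ℕ → Set
OccursAt τ σ i = (i + length τ ≤ length σ) ×
  (∀ a c → a < length τ → c < length τ → (nth σ (i + a) <ᵇ nth σ (i + c)) ≡ (nth τ a <ᵇ nth τ c))

occursAt : List ℕ → List ℕ → ℕ → Bool
occursAt τ σ i = stIs (take (length τ) (drop i σ)) τ

occursAt-sound : ∀ {M} τ σ i → length τ ≡ suc M → occursAt τ σ i ≡ true → OccursAt τ σ i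
occursAt-sound τ σ i |τ|≡ e with stIs-sound (take (length τ) (drop i σ)) τ e
... | same-length , same =
  window-fits⁻ i (length τ) σ (subst (0 <_) (sym |τ|≡) z<s) same-length ,
  λ a c a<L c<L → trans (sym (cong₂ _<ᵇ_ (nth-window i (length τ) σ a a<L) (nth-window i (length τ) σ c c<L))) (same a c a<L c<L)

occursAt-complete : ∀ τ σ i → OccursAt τ σ i → occursAt τ σ i ≡ true
occursAt-complete τ σ i (fits , same) =
  stIs-complete (take (length τ) (drop i σ)) τ (window-fits i (length τ) σ fits)
    (λ a c a<L c<L → trans (cong₂ _<ᵇ_ (nth-window i (length τ) σ a a<L) (nth-window i (length τ) σ c c<L)) (same a c a<L c<L))

occMarks : List ℕ → List ℕ → List Bool
occMarks τ σ = map (occursAt τ σ) (upTo (length σ))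

length-occMarks : ∀ τ σ → length (occMarks τ σ) ≡ length σ
length-occMarks τ σ = trans (length-map (occursAt τ σ) (upTo (length σ))) (length-upTo (length σ))

occMarks-sound : ∀ τ σ i → marked (occMarks τ σ) i ≡ true → i < length σ × occursAt τ σ i ≡ true
occMarks-sound τ σ i e = go (occursAt τ σ) (length σ) i (subst (λ z → marked z i ≡ true) (map-upTo (occursAt τ σ) (length σ)) e)
  where
  go : ∀ h N i → marked (applyUpTo h N) i ≡ true → i < N × h i ≡ true
  go h (suc N) zero    e = z<s , e
  go h (suc N) (suc i) e = map₁ s≤s (go (λ k → h (suc k)) N i e)

occMarks-complete : ∀ τ σ i → i < length σ → occursAt τ σ i ≡ true → marked (occMarks τ σ) i ≡ true
occMarks-complete τ σ i i<σ e = trans (cong (λ z → marked z i) (map-upTo (occursAt τ σ) (length σ))) (trans (go (occursAt τ σ) (length σ) i i<σ) e)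
  where
  go : ∀ h N i → i < N → marked (applyUpTo h N) i ≡ h i
  go h (suc N) zero    _         = refl
  go h (suc N) (suc i) (s≤s i<N) = go (λ k → h (suc k)) N i i<N

Σl-applyUpTo : ∀ (f : ℕ → A) N (h : A → ℕ) → Σl (applyUpTo f N) h ≡ Σr N (λ k → h (f k))
Σl-applyUpTo f zero    h = refl
Σl-applyUpTo f (suc N) h = cong (h (f 0) +_) (Σl-applyUpTo (λ k → f (suc k)) N h)

-- The number of occurrences is the size of the occurrence marking (the
-- definition scans only the start positions where τ fits).
occurrences≡size : ∀ {M} τ σ → length τ ≡ suc M → occurrences τ σ ≡ size (occMarks τ σ)
occurrences≡size {M} τ σ |τ|≡ = begin
    occurrences τ σ
  ≡⟨ length-filter-Σ (λ i → T? (occursAt τ σ i)) (upTo (suc (length σ) ∸ length τ)) ⟩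
    Σl (upTo (suc (length σ) ∸ length τ)) occ
  ≡⟨ cong (λ z → Σl (upTo (suc (length σ) ∸ z)) occ) |τ|≡ ⟩
    Σl (upTo N) occ
  ≡⟨ Σl-applyUpTo (λ i → i) N occ ⟩
    Σr N occ
  ≡⟨ sym (+-identityʳ _) ⟩
    Σr N occ + 0
  ≡⟨ cong (Σr N occ +_) (sym (Σr-zero (length σ ∸ N) _ too-late)) ⟩
    Σr N occ + Σr (length σ ∸ N) (λ i → occ (N + i))
  ≡⟨ sym (Σr-split N (length σ ∸ N) occ) ⟩
    Σr (N + (length σ ∸ N)) occ
  ≡⟨ cong (λ z → Σr z occ) (m+[n∸m]≡n (m∸n≤m (length σ) M)) ⟩
    Σr (length σ) occ
  ≡⟨ sym (Σl-applyUpTo (λ i → i) (length σ) occ) ⟩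
    Σl (upTo (length σ)) occ
  ≡⟨ sym (Σl-map (occursAt τ σ) (upTo (length σ)) ind) ⟩
    size (occMarks τ σ) ∎
  where
  open ≡-Reasoning
  N = length σ ∸ M
  occ = λ i → ind (occursAt τ σ i)
  too-late : ∀ i → i < length σ ∸ N → occ (N + i) ≡ 0
  too-late i _ with occursAt τ σ (N + i) in e
  ... | false = refl
  ... | true  = ⊥-elim (<⇒≱ (m+n≤o⇒m≤o∸n (suc (N + i)) fits) (m≤m+n N i))
    where
    fits : suc (N + i) + M ≤ length σ
    fits = subst (λ z → z ≤ length σ) (trans (cong (N + i +_) |τ|≡) (+-suc (N + i) M)) (proj₁ (occursAt-sound τ σ (N + i) |τ|≡ e))

unique-length-≤ : (xs ys : List A) → Unique xs → (∀ {x} → x ∈ xs → x ∈ ys) → length xs ≤ length ys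
unique-length-≤ []       ys _          _   = z≤n
unique-length-≤ (x ∷ xs) ys (x∉ ∷ uxs) sub with ∈-∃++ (sub (here refl))
... | ys₁ , ys₂ , refl = ≤-trans (s≤s (unique-length-≤ xs (ys₁ ++ ys₂) uxs sub′)) (≤-reflexive length-eq)
  where
  sub′ : ∀ {z} → z ∈ xs → z ∈ ys₁ ++ ys₂
  sub′ {z} z∈ with ∈-++⁻ ys₁ (sub (there z∈))
  ... | inj₁ z∈₁         = ∈-++⁺ˡ z∈₁
  ... | inj₂ (here refl) = ⊥-elim (lookup x∉ z∈ refl)
  ... | inj₂ (there z∈₂) = ∈-++⁺ʳ ys₁ z∈₂
  length-eq : suc (length (ys₁ ++ ys₂)) ≡ length (ys₁ ++ x ∷ ys₂)
  length-eq rewrite length-++ ys₁ {ys₂} | length-++ ys₁ {x ∷ ys₂} = sym (+-suc (length ys₁) (length ys₂))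

pigeonhole : ∀ N (xs : List ℕ) → Unique xs → All (_< N) xs → length xs ≡ N → ∀ v → v < N → v ∈ xs
pigeonhole N xs uxs xs<N |xs|≡N v v<N with v ∈? xs
... | yes v∈ = v∈
... | no  v∉ = ⊥-elim (1+n≰n (≤-trans (unique-length-≤ (v ∷ xs) (upTo N) (¬Any⇒All¬ xs v∉ ∷ uxs) sub)
                                      (≤-reflexive (trans (length-upTo N) (sym |xs|≡N)))))
  where
  sub : ∀ {z} → z ∈ v ∷ xs → z ∈ upTo N
  sub (here refl) = ∈-upTo⁺ v<N
  sub (there z∈)  = ∈-upTo⁺ (lookup xs<N z∈)

unique-map : (f : A → B) (xs : List A) → Unique xs →
  (∀ {x y} → x ∈ xs → y ∈ xs → f x ≡ f y → x ≡ y) → Unique (map f xs)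
unique-map f []       _          _   = []
unique-map f (x ∷ xs) (x∉ ∷ uxs) inj =
  fresh xs (λ y∈ e → lookup x∉ y∈ (inj (here refl) (there y∈) e)) ∷
  unique-map f xs uxs (λ x∈ y∈ e → inj (there x∈) (there y∈) e)
  where
  fresh : ∀ ys → (∀ {y} → y ∈ ys → f x ≡ f y → ⊥) → All (λ z → ¬ (f x ≡ z)) (map f ys)
  fresh []       _ = []
  fresh (y ∷ ys) h = h (here refl) ∷ fresh ys (λ y∈ → h (there y∈))

module Standardise (w : List ℕ) (uw : Unique w) where

  L = length w

  rank : ℕ → ℕ
  rank a = Σl (upTo L) (λ c → ind (nth w c <ᵇ nth w a))

  st : List ℕ
  st = applyUpTo rank L

  rank-< : ∀ a → a < L → rank a < L
  rank-< a a<L = ≤-trans (Σl-ind-< (upTo L) _ (∈-upTo⁺ a<L) (<ᵇ-false {nth w a} ≤-refl)) (≤-reflexive (length-upTo L))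

  rank-mono : ∀ a c → a < L → nth w a < nth w c → rank a < rank c
  rank-mono a c a<L wa<wc = Σl-mono-< (upTo L) _ _ smaller-than-a (∈-upTo⁺ a<L) a-itself
    where
    smaller-than-a : ∀ x → ind (nth w x <ᵇ nth w a) ≤ ind (nth w x <ᵇ nth w c)
    smaller-than-a x with nth w x <ᵇ nth w a in wx<wa
    ... | false = z≤n
    ... | true rewrite <ᵇ-true (<-trans (<ᵇ⇒< _ _ (≡true⇒T wx<wa)) wa<wc) = ≤-refl
    a-itself : ind (nth w a <ᵇ nth w a) < ind (nth w a <ᵇ nth w c)
    a-itself rewrite <ᵇ-false {nth w a} ≤-refl | <ᵇ-true wa<wc = s≤s z≤n

  rank-order : ∀ a c → a < L → c < L → (rank a <ᵇ rank c) ≡ (nth w a <ᵇ nth w c)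
  rank-order a c a<L c<L with <-cmp (nth w a) (nth w c)
  ... | tri< lt _ _ rewrite <ᵇ-true lt = <ᵇ-true (rank-mono a c a<L lt)
  ... | tri≈ _ e _ rewrite nth-injective w a c uw a<L c<L e = trans (<ᵇ-false {rank c} ≤-refl) (sym (<ᵇ-false {nth w c} ≤-refl))
  ... | tri> _ _ gt rewrite <ᵇ-false (<⇒≤ gt) = <ᵇ-false (<⇒≤ (rank-mono c a c<L gt))

  rank-injective : ∀ a c → a < L → c < L → rank a ≡ rank c → a ≡ c
  rank-injective a c a<L c<L e with <-cmp (nth w a) (nth w c)
  ... | tri< lt _ _ = ⊥-elim (<-irrefl e (rank-mono a c a<L lt))
  ... | tri≈ _ e′ _ = nth-injective w a c uw a<L c<L e′
  ... | tri> _ _ gt = ⊥-elim (<-irrefl (sym e) (rank-mono c a c<L gt))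

  st-order : SameOrder st w L
  st-order a c a<L c<L = trans (cong₂ _<ᵇ_ (nth-applyUpTo rank L a a<L) (nth-applyUpTo rank L c c<L)) (rank-order a c a<L c<L)

  st-perm : IsPerm L st
  st-perm = length-applyUpTo rank L ,
    subst Unique (map-upTo rank L) (unique-map rank (upTo L) (Unique.upTo⁺ L) (λ a∈ c∈ → rank-injective _ _ (∈-upTo⁻ a∈) (∈-upTo⁻ c∈))) ,
    tabulate (λ v∈ → below (subst (_ ∈_) (sym (map-upTo rank L)) v∈))
    where
    below : ∀ {z} → z ∈ map rank (upTo L) → z < L
    below z∈ with ∈-map⁻ rank z∈
    ... | a , a∈ , refl = rank-< a (∈-upTo⁻ a∈)

two-occurrences : ∀ {M} τ ρ d → length τ ≡ suc M → 0 < d →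
  OccursAt τ ρ 0 → OccursAt τ ρ d → 2 ≤ occurrences τ ρ
two-occurrences τ ρ d |τ|≡ 0<d occ₀ occ_d =
  subst (2 ≤_) (sym (trans (occurrences≡size τ ρ |τ|≡) (Σl-map (occursAt τ ρ) (upTo (length ρ)) ind)))
    (Σl-two (upTo (length ρ)) (λ i → ind (occursAt τ ρ i)) (∈-upTo⁺ (fits 0 occ₀)) (∈-upTo⁺ (fits d occ_d))
      (λ e → <-irrefl e 0<d) (counted 0 occ₀) (counted d occ_d))
  where
  fits : ∀ i → OccursAt τ ρ i → i < length ρ
  fits i (i+|τ|≤ , _) = <-≤-trans (subst (λ z → i < i + z) (sym |τ|≡) (m<m+n i z<s)) i+|τ|≤
  counted : ∀ i → OccursAt τ ρ i → 1 ≤ ind (occursAt τ ρ i)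
  counted i occ = ≤-reflexive (sym (cong ind (occursAt-complete τ ρ i occ)))

-- In a permutation, two occurrences of a pattern of length m+1 without
-- self-overlaps start at least m apart: otherwise the standardised window
-- covering both would be a permutation of length ≤ 2m with two occurrences.
occurrences-spread : ∀ m τ → length τ ≡ suc m → NoSelfOverlap τ → ∀ σ → Unique σ →
  ∀ i i′ → i < i′ → OccursAt τ σ i → OccursAt τ σ i′ → i + m ≤ i′
occurrences-spread m τ |τ|≡ no-overlap σ uσ i i′ i<i′ occ occ′ with i + m ≤? i′
... | yes far = far
... | no  near = ⊥-elim (<⇒≱ (two-occurrences τ ρ d |τ|≡ 0<d (in-window 0 z≤n occ-at-0) (in-window d ≤-refl occ-at-d)) at-most-one)
  where
  d = i′ ∸ i
  i+d≡i′ : i + d ≡ i′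
  i+d≡i′ = m+[n∸m]≡n (<⇒≤ i<i′)
  0<d : 0 < d
  0<d = m<n⇒0<n∸m i<i′
  d<m : d < m
  d<m = +-cancelˡ-< i d m (subst (_< i + m) (sym i+d≡i′) (≰⇒> near))
  K = suc m + d
  window-fits-σ : i + K ≤ length σ
  window-fits-σ = subst (_≤ length σ) shift (subst (λ z → i′ + z ≤ length σ) |τ|≡ (proj₁ occ′))
    where
    shift : i′ + suc m ≡ i + K
    shift = trans (cong (_+ suc m) (sym i+d≡i′)) (trans (+-assoc i d (suc m)) (cong (i +_) (+-comm d (suc m))))
  w = take K (drop i σ)
  open Standardise w (Unique.take⁺ K (Unique.drop⁺ i uσ)) renaming (st to ρ)
  |w|≡K : L ≡ K
  |w|≡K = window-fits i K σ window-fits-σ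
  |ρ|≡K : length ρ ≡ K
  |ρ|≡K = trans (length-applyUpTo rank L) |w|≡K
  occ-at-0 : OccursAt τ σ (i + 0)
  occ-at-0 = subst (OccursAt τ σ) (sym (+-identityʳ i)) occ
  occ-at-d : OccursAt τ σ (i + d)
  occ-at-d = subst (OccursAt τ σ) (sym i+d≡i′) occ′
  in-window : ∀ j → j ≤ d → OccursAt τ σ (i + j) → OccursAt τ ρ j
  in-window j j≤d (_ , same) = fits-ρ , same-ρ
    where
    j+τ≤K : j + length τ ≤ K
    j+τ≤K = subst (λ z → j + z ≤ K) (sym |τ|≡) (subst (_≤ K) (+-comm (suc m) j) (+-monoʳ-≤ (suc m) j≤d))
    fits-ρ : j + length τ ≤ length ρ
    fits-ρ = subst (j + length τ ≤_) (sym |ρ|≡K) j+τ≤K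
    inside : ∀ a → a < length τ → j + a < K
    inside a a<τ = <-≤-trans (+-monoʳ-< j a<τ) j+τ≤K
    same-ρ : ∀ a c → a < length τ → c < length τ → (nth ρ (j + a) <ᵇ nth ρ (j + c)) ≡ (nth τ a <ᵇ nth τ c)
    same-ρ a c a<τ c<τ = begin
        (nth ρ (j + a) <ᵇ nth ρ (j + c))
      ≡⟨ st-order (j + a) (j + c) (subst (j + a <_) (sym |w|≡K) (inside a a<τ)) (subst (j + c <_) (sym |w|≡K) (inside c c<τ)) ⟩
        (nth w (j + a) <ᵇ nth w (j + c))
      ≡⟨ cong₂ _<ᵇ_ (nth-window i K σ (j + a) (inside a a<τ)) (nth-window i K σ (j + c) (inside c c<τ)) ⟩
        (nth σ (i + (j + a)) <ᵇ nth σ (i + (j + c)))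
      ≡⟨ cong₂ _<ᵇ_ (cong (nth σ) (sym (+-assoc i j a))) (cong (nth σ) (sym (+-assoc i j c))) ⟩
        (nth σ (i + j + a) <ᵇ nth σ (i + j + c))
      ≡⟨ same a c a<τ c<τ ⟩
        (nth τ a <ᵇ nth τ c) ∎
      where open ≡-Reasoning
  -- ρ is short enough for the no-self-overlap hypothesis: K = m + 1 + d ≤ 2m = 2|τ| - 2
  short : length ρ ≤ 2 * length τ ∸ 2
  short = subst₂ _≤_ (sym |ρ|≡K) (sym (trans (cong (λ z → 2 * z ∸ 2) |τ|≡) (twice m)))
            (≤-trans (≤-reflexive (sym (+-suc m d))) (+-monoʳ-≤ m d<m))
    where
    twice : ∀ m → 2 * suc m ∸ 2 ≡ m + m
    twice m rewrite +-identityʳ m | +-suc m m = refl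
  at-most-one : occurrences τ ρ ≤ 1
  at-most-one = no-overlap (length ρ) ρ short (subst (λ z → IsPerm z ρ) (sym (length-applyUpTo rank L)) st-perm)

indexOf : List ℕ → ℕ → ℕ
indexOf []       v = 0
indexOf (x ∷ xs) v = if x ≡ᵇ v then 0 else suc (indexOf xs v)

indexOf-sound : ∀ xs v → v ∈ xs → nth xs (indexOf xs v) ≡ v × indexOf xs v < length xs
indexOf-sound (x ∷ xs) v v∈ with x ≡ᵇ v in x≡ᵇv | v∈
... | true  | _          = ≡ᵇ⇒≡ x v (≡true⇒T x≡ᵇv) , s≤s z≤n
... | false | here refl  = ⊥-elim (subst T x≡ᵇv (≡⇒≡ᵇ x x refl))
... | false | there v∈xs = map₂ s≤s (indexOf-sound xs v v∈xs)

indexOf-nth : ∀ xs a → Unique xs → a < length xs → indexOf xs (nth xs a) ≡ a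
indexOf-nth xs a uxs a<l with indexOf-sound xs (nth xs a) (nth-∈ xs a a<l)
... | at , below = nth-injective xs _ a uxs below a<l at

module Relabel (m : ℕ) (τ τ′ : List ℕ) (hτ : IsPerm (suc m) τ) (hτ′ : IsPerm (suc m) τ′) where

  π : ℕ → ℕ
  π a = indexOf τ (nth τ′ a)

  private
    offset-in : ∀ (xs : List ℕ) a → length xs ≡ suc m → a ≤ m → a < length xs
    offset-in xs a |xs|≡ a≤m = subst (a <_) (sym |xs|≡) (s≤s a≤m)

    letter-in-τ : ∀ a → a ≤ m → nth τ′ a ∈ τ
    letter-in-τ a a≤m = pigeonhole (suc m) τ (proj₁ (proj₂ hτ)) (proj₂ (proj₂ hτ)) (proj₁ hτ) (nth τ′ a)
      (nth-All τ′ a (proj₂ (proj₂ hτ′)) (offset-in τ′ a (proj₁ hτ′) a≤m))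

  π-≤ : ∀ a → a ≤ m → π a ≤ m
  π-≤ a a≤m = ≤-pred (subst (π a <_) (proj₁ hτ) (proj₂ (indexOf-sound τ _ (letter-in-τ a a≤m))))

  π-spec : ∀ a → a ≤ m → nth τ (π a) ≡ nth τ′ a
  π-spec a a≤m = proj₁ (indexOf-sound τ _ (letter-in-τ a a≤m))

  π-cancel : ∀ a → a ≤ m → indexOf τ′ (nth τ (π a)) ≡ a
  π-cancel a a≤m = trans (cong (indexOf τ′) (π-spec a a≤m)) (indexOf-nth τ′ a (proj₁ (proj₂ hτ′)) (offset-in τ′ a (proj₁ hτ′) a≤m))

  π-fixes : ∀ a → a ≤ m → nth τ a ≡ nth τ′ a → π a ≡ a
  π-fixes a a≤m same = trans (cong (indexOf τ) (sym same)) (indexOf-nth τ a (proj₁ (proj₂ hτ)) (offset-in τ a (proj₁ hτ) a≤m))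

  π-first : head τ ≡ head τ′ → π 0 ≡ 0
  π-first same-head = π-fixes 0 z≤n (first (proj₁ hτ) (proj₁ hτ′) same-head)
    where
    first : ∀ {xs ys : List ℕ} → length xs ≡ suc m → length ys ≡ suc m → head xs ≡ head ys → nth xs 0 ≡ nth ys 0
    first {x ∷ _} {y ∷ _} _ _ refl = refl

  π-last : last τ ≡ last τ′ → π m ≡ m
  π-last same-last = π-fixes m ≤-refl (just-injective (trans (sym (last-nth τ m (proj₁ hτ))) (trans same-last (last-nth τ′ m (proj₁ hτ′)))))
    where
    just-injective : ∀ {x y : ℕ} → just x ≡ just y → x ≡ y
    just-injective refl = refl
    last-nth : ∀ (xs : List ℕ) k → length xs ≡ suc k → last xs ≡ just (nth xs k)
    last-nth (x ∷ [])     zero    _ = refl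
    last-nth (x ∷ y ∷ xs) (suc k) e = last-nth (y ∷ xs) k (suc-injective e)

module Windows (m : ℕ) (b : List Bool) where

  -- marked positions are at least m apart, so windows share at most an end
  Spread : Set
  Spread = ∀ i j → marked b i ≡ true → marked b j ≡ true → i < j → i + m ≤ j

  nearestMark : ℕ → ℕ → Maybe ℕ
  nearestMark p zero    = nothing
  nearestMark p (suc d) = if (suc d ≤ᵇ p) ∧ marked b (p ∸ suc d) then just (suc d) else nearestMark p d

  nearestMark-just : ∀ p D d → nearestMark p D ≡ just d → (1 ≤ d) × (d ≤ D) × (d ≤ p) × (marked b (p ∸ d) ≡ true)
  nearestMark-just p (suc D) d e with (suc D ≤ᵇ p) ∧ marked b (p ∸ suc D) in found
  nearestMark-just p (suc D) d refl | true with ∧-true _ _ found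
  ... | fits , mark = s≤s z≤n , ≤-refl , ≤ᵇ⇒≤ (suc D) p (≡true⇒T fits) , mark
  nearestMark-just p (suc D) d e | false with nearestMark-just p D d e
  ... | 1≤d , d≤D , d≤p , mark = 1≤d , m≤n⇒m≤1+n d≤D , d≤p , mark

  nearestMark-nothing : ∀ p D → nearestMark p D ≡ nothing → ∀ d → 1 ≤ d → d ≤ D → d ≤ p → marked b (p ∸ d) ≡ false
  nearestMark-nothing p zero    e (suc d) 1≤d () d≤p
  nearestMark-nothing p (suc D) e d 1≤d d≤D d≤p with (suc D ≤ᵇ p) ∧ marked b (p ∸ suc D) in found
  nearestMark-nothing p (suc D) () d 1≤d d≤D d≤p | true
  ... | false with m≤n⇒m<n∨m≡n d≤D
  ... | inj₁ (s≤s d≤D′) = nearestMark-nothing p D e d 1≤d d≤D′ d≤p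
  ... | inj₂ refl rewrite T⇒≡true (suc D ≤ᵇ p) (≤⇒≤ᵇ d≤p) = found

  -- apply the offset relabelling π inside every window interior
  rearrange : (ℕ → ℕ) → ℕ → ℕ
  rearrange π p with nearestMark p (m ∸ 1)
  ... | nothing = p
  ... | just d  = (p ∸ d) + π d

  private
    interior-< : ∀ d → 1 ≤ d → d ≤ m ∸ 1 → d < m
    interior-< d 1≤d d≤m-1 = ≤-trans (≤-reflexive (+-comm 1 d)) (m≤o∸n⇒m+n≤o d (≤-trans 1≤d (≤-trans d≤m-1 (m∸n≤m m 1))) d≤m-1)

  same-window : Spread → ∀ i j p → marked b i ≡ true → marked b j ≡ true →
    i ≤ p → p ≤ i + m → j < p → p < j + m → j ≡ i
  same-window spread i j p bi bj i≤p p≤i+m j<p p<j+m with <-cmp j i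
  ... | tri< j<i _ _ = ⊥-elim (<⇒≱ p<j+m (≤-trans (spread j i bj bi j<i) i≤p))
  ... | tri≈ _ j≡i _ = j≡i
  ... | tri> _ _ i<j = ⊥-elim (<⇒≱ j<p (≤-trans p≤i+m (spread i j bi bj i<j)))

  module _ (spread : Spread) (π : ℕ → ℕ) (π-first : π 0 ≡ 0) (π-last : π m ≡ m) where

    rearrange-window : ∀ i a → marked b i ≡ true → a ≤ m → rearrange π (i + a) ≡ i + π a
    rearrange-window i a bi a≤m with nearestMark (i + a) (m ∸ 1) in found
    ... | just d with nearestMark-just (i + a) (m ∸ 1) d found
    ...   | 1≤d , d≤m-1 , d≤p , bj = cong₂ _+_ j≡i (cong π d≡a)
      where
      j≡i : i + a ∸ d ≡ i
      j≡i = same-window spread i (i + a ∸ d) (i + a) bi bj (m≤m+n i a) (+-monoʳ-≤ i a≤m)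
              (∸-monoʳ-< 1≤d d≤p) (subst (_< i + a ∸ d + m) (m∸n+n≡m d≤p) (+-monoʳ-< (i + a ∸ d) (interior-< d 1≤d d≤m-1)))
      d≡a : d ≡ a
      d≡a = +-cancelˡ-≡ i d a (trans (cong (_+ d) (sym j≡i)) (m∸n+n≡m d≤p))
    rearrange-window i a bi a≤m | nothing with a ≟ 0 | a ≟ m
    ... | yes refl | _        = cong (i +_) (sym π-first)
    ... | no  _    | yes refl = cong (i +_) (sym π-last)
    ... | no  a≢0  | no  a≢m  = ⊥-elim (true≢false (trans (sym bi) (subst (λ z → marked b z ≡ false) (m+n∸n≡m i a)
                                  (nearestMark-nothing (i + a) (m ∸ 1) found a (n≢0⇒n>0 a≢0) interior (m≤n+m a i)))))
      where
      true≢false : true ≢ false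
      true≢false ()
      interior : a ≤ m ∸ 1
      interior = m+n≤o⇒m≤o∸n a (≤-trans (≤-reflexive (+-comm a 1)) (≤∧≢⇒< a≤m a≢m))

    rearrange-undoes : ∀ ψ → (∀ a → a ≤ m → ψ a ≤ m) → (∀ a → a ≤ m → π (ψ a) ≡ a) →
      ∀ p → rearrange π (rearrange ψ p) ≡ p
    rearrange-undoes ψ ψ-≤ πψ p with nearestMark p (m ∸ 1) in found
    ... | nothing rewrite found = refl
    ... | just d with nearestMark-just p (m ∸ 1) d found
    ...   | _ , d≤m-1 , d≤p , bj = begin
        rearrange π ((p ∸ d) + ψ d)  ≡⟨ rearrange-window (p ∸ d) (ψ d) bj (ψ-≤ d d≤m) ⟩
        (p ∸ d) + π (ψ d)            ≡⟨ cong ((p ∸ d) +_) (πψ d d≤m) ⟩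
        (p ∸ d) + d                  ≡⟨ m∸n+n≡m d≤p ⟩
        p                            ∎
      where
      open ≡-Reasoning
      d≤m = ≤-trans d≤m-1 (m∸n≤m m 1)

  rearrange-< : ∀ n ψ → (∀ i → marked b i ≡ true → i + m < n) → (∀ a → a ≤ m → ψ a ≤ m) →
    ∀ p → p < n → rearrange ψ p < n
  rearrange-< n ψ windows-fit ψ-≤ p p<n with nearestMark p (m ∸ 1) in found
  ... | nothing = p<n
  ... | just d with nearestMark-just p (m ∸ 1) d found
  ...   | _ , d≤m-1 , _ , bj = ≤-<-trans (+-monoʳ-≤ (p ∸ d) (ψ-≤ d (≤-trans d≤m-1 (m∸n≤m m 1)))) (windows-fit (p ∸ d) bj)

words-complete : ∀ n len (w : List ℕ) → length w ≡ len → All (_< n) w → w ∈ words n len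
words-complete n zero      []      _ _ = here refl
words-complete n (suc len) (x ∷ w) e (x<n ∷ w<n) =
  ∈-concatMap⁺ (λ x → map (x ∷_) (words n len))
    (Any.map (λ { refl → ∈-map⁺ (x ∷_) (words-complete n len w (suc-injective e) w<n) }) (∈-upTo⁺ x<n))

words-unique : ∀ n len → Unique (words n len)
words-unique n zero      = [] ∷ []
words-unique n (suc len) = prefixed (upTo n) (Unique.upTo⁺ n)
  where
  Ws = words n len
  prefixed : (xs : List ℕ) → Unique xs → Unique (concatMap (λ x → map (x ∷_) Ws) xs)
  prefixed []       _          = []
  prefixed (x ∷ xs) (x∉ ∷ uxs) = Unique.++⁺ (Unique.map⁺ ∷-injectiveʳ (words-unique n len)) (prefixed xs uxs) disjoint
    where
    disjoint : ∀ {v} → ¬ (v ∈ map (x ∷_) Ws × v ∈ concatMap (λ x → map (x ∷_) Ws) xs)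
    disjoint (v∈₁ , v∈₂) with ∈-map⁻ (x ∷_) v∈₁ | find (∈-concatMap⁻ (λ x → map (x ∷_) Ws) {xs = xs} v∈₂)
    ... | _ , _ , refl | y , y∈ , v∈y with ∈-map⁻ (y ∷_) v∈y
    ...   | _ , _ , e = lookup x∉ y∈ (∷-injectiveˡ e)

injection-count : (W : List A) → Unique W → (Q Q′ : A → Bool) (F G : A → A) →
  (∀ x → x ∈ W → Q x ≡ true → F x ∈ W × Q′ (F x) ≡ true × G (F x) ≡ x) →
  Σl W (λ x → ind (Q x)) ≤ Σl W (λ x → ind (Q′ x))
injection-count W uW Q Q′ F G into =
  subst₂ _≤_ (length-filter-Σ (λ x → T? (Q x)) W) (length-filter-Σ (λ x → T? (Q′ x)) W)
    (≤-trans (≤-reflexive (sym (length-map F xs))) (unique-length-≤ (map F xs) (filter (λ x → T? (Q′ x)) W) unique-image image-⊆))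
  where
  xs = filter (λ x → T? (Q x)) W
  member : ∀ {x} → x ∈ xs → x ∈ W × Q x ≡ true
  member x∈ with ∈-filter⁻ (λ x → T? (Q x)) x∈
  ... | x∈W , Qx = x∈W , T⇒≡true _ Qx
  unique-image : Unique (map F xs)
  unique-image = unique-map F xs (Unique.filter⁺ (λ x → T? (Q x)) uW) injective
    where
    injective : ∀ {x y} → x ∈ xs → y ∈ xs → F x ≡ F y → x ≡ y
    injective x∈ y∈ e with member x∈ | member y∈
    ... | x∈W , Qx | y∈W , Qy = trans (sym (proj₂ (proj₂ (into _ x∈W Qx)))) (trans (cong G e) (proj₂ (proj₂ (into _ y∈W Qy))))
  image-⊆ : ∀ {z} → z ∈ map F xs → z ∈ filter (λ x → T? (Q′ x)) W
  image-⊆ z∈ with ∈-map⁻ F z∈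
  ... | x , x∈ , refl with member x∈
  ...   | x∈W , Qx with into x x∈W Qx
  ...     | Fx∈W , Q′Fx , _ = ∈-filter⁺ (λ x → T? (Q′ x)) Fx∈W (≡true⇒T Q′Fx)

reindex : (ℕ → ℕ) → List ℕ → List ℕ
reindex f σ = applyUpTo (λ p → nth σ (f p)) (length σ)

reindex-length : ∀ f σ → length (reindex f σ) ≡ length σ
reindex-length f σ = length-applyUpTo _ (length σ)

reindex-nth : ∀ f σ p → p < length σ → nth (reindex f σ) p ≡ nth σ (f p)
reindex-nth f σ p = nth-applyUpTo _ (length σ) p

reindex-perm : ∀ n f g σ → IsPerm n σ → (∀ p → p < n → f p < n) → (∀ p → p < n → g (f p) ≡ p) →
  IsPerm n (reindex f σ)
reindex-perm n f g σ (|σ|≡n , uσ , σ<n) f-< gf =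
  trans (reindex-length f σ) |σ|≡n ,
  subst Unique (map-upTo _ (length σ)) (unique-map _ (upTo (length σ)) (Unique.upTo⁺ (length σ)) injective) ,
  tabulate below
  where
  in-σ : ∀ p → p < length σ → f p < length σ
  in-σ p p<σ = subst (f p <_) (sym |σ|≡n) (f-< p (subst (p <_) |σ|≡n p<σ))
  injective : ∀ {x y} → x ∈ upTo (length σ) → y ∈ upTo (length σ) → nth σ (f x) ≡ nth σ (f y) → x ≡ y
  injective {x} {y} x∈ y∈ e = begin
      x          ≡⟨ sym (gf x (subst (x <_) |σ|≡n (∈-upTo⁻ x∈))) ⟩
      g (f x)    ≡⟨ cong g (nth-injective σ _ _ uσ (in-σ x (∈-upTo⁻ x∈)) (in-σ y (∈-upTo⁻ y∈)) e) ⟩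
      g (f y)    ≡⟨ gf y (subst (y <_) |σ|≡n (∈-upTo⁻ y∈)) ⟩
      y          ∎
    where open ≡-Reasoning
  below : ∀ {v} → v ∈ reindex f σ → v < n
  below v∈ with ∈-applyUpTo⁻ (λ p → nth σ (f p)) v∈
  ... | p , p<σ , refl = nth-All σ (f p) σ<n (in-σ p p<σ)

reindex-undo : ∀ f g σ → (∀ p → p < length σ → g p < length σ) → (∀ p → p < length σ → f (g p) ≡ p) →
  reindex g (reindex f σ) ≡ σ
reindex-undo f g σ g-< fg = begin
    applyUpTo (λ p → nth (reindex f σ) (g p)) (length (reindex f σ))
  ≡⟨ cong (applyUpTo _) (reindex-length f σ) ⟩
    applyUpTo (λ p → nth (reindex f σ) (g p)) (length σ)
  ≡⟨ applyUpTo-cong (length σ) (λ p p<σ → trans (reindex-nth f σ (g p) (g-< p p<σ)) (cong (nth σ) (fg p p<σ))) ⟩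
    applyUpTo (nth σ) (length σ)
  ≡⟨ applyUpTo-nth σ ⟩
    σ ∎
  where
  open ≡-Reasoning
  applyUpTo-cong : ∀ {h k : ℕ → ℕ} N → (∀ q → q < N → h q ≡ k q) → applyUpTo h N ≡ applyUpTo k N
  applyUpTo-cong zero    _ = refl
  applyUpTo-cong (suc N) e = cong₂ _∷_ (e 0 z<s) (applyUpTo-cong N (λ q q<N → e (suc q) (s≤s q<N)))
  applyUpTo-nth : ∀ (xs : List ℕ) → applyUpTo (nth xs) (length xs) ≡ xs
  applyUpTo-nth []       = refl
  applyUpTo-nth (x ∷ xs) = cong (x ∷_) (applyUpTo-nth xs)

does-sound : ∀ {P : Set} (d : Dec P) → does d ≡ true → P
does-sound (yes p) _ = p

does-complete : ∀ {P : Set} (d : Dec P) → P → does d ≡ true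
does-complete (yes _) _ = refl
does-complete (no ¬p) p = ⊥-elim (¬p p)

-- σ is a permutation of length n in which every position marked in b starts
-- an occurrence of τ; respecting τ n b = N_τ(b) counts these σ.
respects : ℕ → List Bool → List ℕ → List ℕ → Bool
respects n b τ σ = does (isPerm? n σ) ∧ (b ⊆ᵇ occMarks τ σ)

respecting : List ℕ → ℕ → List Bool → ℕ
respecting τ n b = Σl (words n n) (λ σ → ind (respects n b τ σ))

-- Rearranging inside the marked windows carries the permutations respecting
-- b for τ injectively into those respecting b for τ′.
module Transfer (n m : ℕ) (τ τ′ : List ℕ) (hτ : IsPerm (suc m) τ) (hτ′ : IsPerm (suc m) τ′)
  (no-overlap : NoSelfOverlap τ) (same-head : head τ ≡ head τ′) (same-last : last τ ≡ last τ′)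
  (b : List Bool) where

  open Relabel m τ τ′ hτ hτ′ using (π; π-≤; π-spec; π-cancel; π-first; π-last)
  open Relabel m τ′ τ hτ′ hτ using () renaming (π to π′; π-≤ to π′-≤; π-cancel to π′-cancel; π-first to π′-first; π-last to π′-last)
  open Windows m b

  forward backward : ℕ → ℕ
  forward  = rearrange π
  backward = rearrange π′

  module _ (σ : List ℕ) (resp : respects n b τ σ ≡ true) where

    σ-perm : IsPerm n σ
    σ-perm = does-sound (isPerm? n σ) (proj₁ (∧-true _ _ resp))

    |σ|≡n : length σ ≡ n
    |σ|≡n = proj₁ σ-perm

    marked⇒occurs : ∀ i → marked b i ≡ true → OccursAt τ σ i
    marked⇒occurs i bi = occursAt-sound τ σ i (proj₁ hτ)
      (proj₂ (occMarks-sound τ σ i (⊆ᵇ-marked b (occMarks τ σ) (proj₂ (∧-true _ _ resp)) i bi)))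

    spread : Spread
    spread i j bi bj i<j = occurrences-spread m τ (proj₁ hτ) no-overlap σ (proj₁ (proj₂ σ-perm)) i j i<j
      (marked⇒occurs i bi) (marked⇒occurs j bj)

    windows-fit : ∀ i → marked b i ≡ true → i + m < n
    windows-fit i bi = subst₂ _≤_ (trans (cong (i +_) (proj₁ hτ)) (+-suc i m)) |σ|≡n (proj₁ (marked⇒occurs i bi))

    backward∘forward : ∀ p → backward (forward p) ≡ p
    backward∘forward = rearrange-undoes spread π′ (π′-first (sym same-head)) (π′-last (sym same-last)) π π-≤ π-cancel

    forward∘backward : ∀ p → forward (backward p) ≡ p
    forward∘backward = rearrange-undoes spread π (π-first same-head) (π-last same-last) π′ π′-≤ π′-cancel

    moved : List ℕ
    moved = reindex forward σ

    moved-perm : IsPerm n moved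
    moved-perm = reindex-perm n forward backward σ σ-perm (rearrange-< n π windows-fit π-≤) (λ p _ → backward∘forward p)

    -- inside a marked window, moved reads σ at offsets relabelled by π, which turns τ into τ′
    moved-occurs : ∀ i → marked b i ≡ true → OccursAt τ′ moved i
    moved-occurs i bi = fits , same
      where
      occ = marked⇒occurs i bi
      fits : i + length τ′ ≤ length moved
      fits = subst₂ (λ z z′ → i + z ≤ z′) (trans (proj₁ hτ) (sym (proj₁ hτ′))) (sym (reindex-length forward σ)) (proj₁ occ)
      offset : ∀ a → a < length τ′ → a ≤ m
      offset a a<τ′ = ≤-pred (subst (a <_) (proj₁ hτ′) a<τ′)
      in-σ : ∀ a → a ≤ m → i + a < length σ
      in-σ a a≤m = subst (i + a <_) (sym |σ|≡n) (≤-<-trans (+-monoʳ-≤ i a≤m) (windows-fit i bi))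
      relabelled : ∀ a → a ≤ m → π a < length τ
      relabelled a a≤m = subst (π a <_) (sym (proj₁ hτ)) (s≤s (π-≤ a a≤m))
      entry : ∀ a → a ≤ m → nth moved (i + a) ≡ nth σ (i + π a)
      entry a a≤m = trans (reindex-nth forward σ (i + a) (in-σ a a≤m))
                          (cong (nth σ) (rearrange-window spread π (π-first same-head) (π-last same-last) i a bi a≤m))
      same : ∀ a c → a < length τ′ → c < length τ′ → (nth moved (i + a) <ᵇ nth moved (i + c)) ≡ (nth τ′ a <ᵇ nth τ′ c)
      same a c a<τ′ c<τ′ = begin
          (nth moved (i + a) <ᵇ nth moved (i + c))
        ≡⟨ cong₂ _<ᵇ_ (entry a a≤m) (entry c c≤m) ⟩
          (nth σ (i + π a) <ᵇ nth σ (i + π c))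
        ≡⟨ proj₂ occ (π a) (π c) (relabelled a a≤m) (relabelled c c≤m) ⟩
          (nth τ (π a) <ᵇ nth τ (π c))
        ≡⟨ cong₂ _<ᵇ_ (π-spec a a≤m) (π-spec c c≤m) ⟩
          (nth τ′ a <ᵇ nth τ′ c) ∎
        where
        open ≡-Reasoning
        a≤m = offset a a<τ′
        c≤m = offset c c<τ′

    moved-respects : respects n b τ′ moved ≡ true
    moved-respects rewrite does-complete (isPerm? n moved) moved-perm = marked-⊆ᵇ b (occMarks τ′ moved) short marks
      where
      short : length b ≤ length (occMarks τ′ moved)
      short = ≤-trans (⊆ᵇ-length b _ (proj₂ (∧-true _ _ resp)))
                (≤-reflexive (trans (length-occMarks τ σ) (trans (sym (reindex-length forward σ)) (sym (length-occMarks τ′ moved)))))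
      marks : ∀ i → marked b i ≡ true → marked (occMarks τ′ moved) i ≡ true
      marks i bi = occMarks-complete τ′ moved i i<moved (occursAt-complete τ′ moved i (moved-occurs i bi))
        where
        i<moved : i < length moved
        i<moved = <-≤-trans (m<m+n i z<s) (≤-trans (+-monoʳ-≤ i (≤-reflexive (sym (proj₁ hτ′)))) (proj₁ (moved-occurs i bi)))

    moved-back : reindex backward moved ≡ σ
    moved-back = reindex-undo forward backward σ
      (λ p p<σ → subst (backward p <_) (sym |σ|≡n) (rearrange-< n π′ windows-fit π′-≤ p (subst (p <_) |σ|≡n p<σ)))
      (λ p _ → forward∘backward p)

  respecting-≤ : respecting τ n b ≤ respecting τ′ n b
  respecting-≤ = injection-count (words n n) (words-unique n n) _ _ (reindex forward) (reindex backward)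
    (λ σ _ resp → words-complete n n (moved σ resp) (proj₁ (moved-perm σ resp)) (proj₂ (proj₂ (moved-perm σ resp))) ,
                  moved-respects σ resp , moved-back σ resp)

-- C(occ_τ σ, j) counts the sets of j occurrence positions of τ in σ.
moment-pointwise : ∀ {M} τ n σ j → length τ ≡ suc M →
  ind (does (isPerm? n σ)) * (occurrences τ σ C j) ≡
  Σl (subsets n) (λ b → ind (size b ≡ᵇ j) * ind (does (isPerm? n σ) ∧ (b ⊆ᵇ occMarks τ σ)))
moment-pointwise τ n σ j |τ|≡ = by-perm (does (isPerm? n σ)) (does-sound (isPerm? n σ))
  where
  open ≡-Reasoning
  marks = occMarks τ σ
  by-perm : ∀ v → (v ≡ true → IsPerm n σ) →
    ind v * (occurrences τ σ C j) ≡ Σl (subsets n) (λ b → ind (size b ≡ᵇ j) * ind (v ∧ (b ⊆ᵇ marks)))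
  by-perm false _ = sym (Σl-zero (subsets n) _ (λ b → *-zeroʳ (ind (size b ≡ᵇ j))))
  by-perm true perm = begin
      1 * (occurrences τ σ C j)
    ≡⟨ *-identityˡ _ ⟩
      occurrences τ σ C j
    ≡⟨ cong (_C j) (occurrences≡size τ σ |τ|≡) ⟩
      size marks C j
    ≡⟨ sym (subsets-of-size marks j) ⟩
      Σl (subsets (length marks)) (λ b → ind ((size b ≡ᵇ j) ∧ (b ⊆ᵇ marks)))
    ≡⟨ cong (λ l → Σl (subsets l) (λ b → ind ((size b ≡ᵇ j) ∧ (b ⊆ᵇ marks)))) (trans (length-occMarks τ σ) (proj₁ (perm refl))) ⟩
      Σl (subsets n) (λ b → ind ((size b ≡ᵇ j) ∧ (b ⊆ᵇ marks)))
    ≡⟨ Σl-cong (subsets n) (λ b → ind-∧ (size b ≡ᵇ j) _) ⟩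
      Σl (subsets n) (λ b → ind (size b ≡ᵇ j) * ind (b ⊆ᵇ marks)) ∎

binomial-moment : ∀ {M} τ n j → length τ ≡ suc M →
  Σl (words n n) (λ σ → ind (does (isPerm? n σ)) * (occurrences τ σ C j)) ≡
  Σl (subsets n) (λ b → ind (size b ≡ᵇ j) * respecting τ n b)
binomial-moment τ n j |τ|≡ = begin
    Σl (words n n) (λ σ → ind (does (isPerm? n σ)) * (occurrences τ σ C j))
  ≡⟨ Σl-cong (words n n) (λ σ → moment-pointwise τ n σ j |τ|≡) ⟩
    Σl (words n n) (λ σ → Σl (subsets n) (λ b → ind (size b ≡ᵇ j) * ind (respects n b τ σ)))
  ≡⟨ Σl-swap (words n n) (subsets n) _ ⟩
    Σl (subsets n) (λ b → Σl (words n n) (λ σ → ind (size b ≡ᵇ j) * ind (respects n b τ σ)))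
  ≡⟨ Σl-cong (subsets n) (λ b → Σl-*ˡ (words n n) (ind (size b ≡ᵇ j)) _) ⟩
    Σl (subsets n) (λ b → ind (size b ≡ᵇ j) * respecting τ n b) ∎
  where open ≡-Reasoning

occurrences-≤ : ∀ {M} τ n σ → length τ ≡ suc M → does (isPerm? n σ) ≡ true → occurrences τ σ < suc n
occurrences-≤ τ n σ |τ|≡ perm = s≤s (begin
    occurrences τ σ                                   ≡⟨ occurrences≡size τ σ |τ|≡ ⟩
    size (occMarks τ σ)                               ≡⟨ Σl-map (occursAt τ σ) (upTo (length σ)) ind ⟩
    Σl (upTo (length σ)) (λ i → ind (occursAt τ σ i)) ≤⟨ Σl-ind-≤ (upTo (length σ)) (occursAt τ σ) ⟩
    length (upTo (length σ))                          ≡⟨ length-upTo (length σ) ⟩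
    length σ                                          ≡⟨ proj₁ (does-sound (isPerm? n σ) perm) ⟩
    n                                                 ∎)
  where open ≤-Reasoning

module _ (m : ℕ) (τ τ′ : List ℕ) (hτ : IsPerm (suc m) τ) (hτ′ : IsPerm (suc m) τ′)
  (no-overlap : NoSelfOverlap τ) (no-overlap′ : NoSelfOverlap τ′)
  (same-head : head τ ≡ head τ′) (same-last : last τ ≡ last τ′) where

  same-respecting : ∀ n b → respecting τ n b ≡ respecting τ′ n b
  same-respecting n b = ≤-antisym (Transfer.respecting-≤ n m τ τ′ hτ hτ′ no-overlap same-head same-last b)
                                  (Transfer.respecting-≤ n m τ′ τ hτ′ hτ no-overlap′ (sym same-head) (sym same-last) b)

  same-moments : ∀ n j → Σl (words n n) (λ σ → ind (does (isPerm? n σ)) * (occurrences τ σ C j)) ≡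
                         Σl (words n n) (λ σ → ind (does (isPerm? n σ)) * (occurrences τ′ σ C j))
  same-moments n j = begin
      Σl (words n n) (λ σ → ind (does (isPerm? n σ)) * (occurrences τ σ C j))
    ≡⟨ binomial-moment τ n j (proj₁ hτ) ⟩
      Σl (subsets n) (λ b → ind (size b ≡ᵇ j) * respecting τ n b)
    ≡⟨ Σl-cong (subsets n) (λ b → cong (ind (size b ≡ᵇ j) *_) (same-respecting n b)) ⟩
      Σl (subsets n) (λ b → ind (size b ≡ᵇ j) * respecting τ′ n b)
    ≡⟨ sym (binomial-moment τ′ n j (proj₁ hτ′)) ⟩
      Σl (words n n) (λ σ → ind (does (isPerm? n σ)) * (occurrences τ′ σ C j)) ∎
    where open ≡-Reasoning

theorem4p10 : (m : ℕ) (τ τ′ : List ℕ) →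
    IsPerm (suc m) τ → IsPerm (suc m) τ′ →
    NoSelfOverlap τ → NoSelfOverlap τ′ →
    head τ ≡ head τ′ → last τ ≡ last τ′ →
    (n k : ℕ) → countPerms τ n k ≡ countPerms τ′ n k
theorem4p10 m τ τ′ hτ hτ′ no-overlap no-overlap′ same-head same-last n k = begin
    countPerms τ n k
  ≡⟨ length-filter-Σ _ (words n n) ⟩
    distribution (words n n) is-perm (occurrences τ) k
  ≡⟨ equal-moments⇒equidistributed (words n n) is-perm (suc n) (occurrences τ) (occurrences τ′)
       (λ σ → occurrences-≤ τ n σ (proj₁ hτ)) (λ σ → occurrences-≤ τ′ n σ (proj₁ hτ′))
       (same-moments m τ τ′ hτ hτ′ no-overlap no-overlap′ same-head same-last n) k ⟩
    distribution (words n n) is-perm (occurrences τ′) k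
  ≡⟨ sym (length-filter-Σ _ (words n n)) ⟩
    countPerms τ′ n k ∎
  where
  open ≡-Reasoning
  is-perm : List ℕ → Bool
  is-perm σ = does (isPerm? n σ)
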